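{- (1) Let $L=\{L(v)\}_{v\in V(C_5)}$ be an assignment of lists of size $3$ to the vertices of the $5$-cycle $C_5$ such that $\left|\bigcup_{v\in V(C_5)}L(v)\right|\neq 3$. Then $C_5$ is properly $L$-distinguishable. (2) Let $L=\{L(v)\}_{v\in V(C_6)}$ be an assignment of lists of size $4$ to the vertices of the $6$-cycle $C_6$ such that $\left|\bigcup_{v\in V(C_6)}L(v)\right|\neq 4$. Then $C_6$ is properly $L$-distinguishable.
   Context: A vertex coloring $f$ of a graph $G$ is distinguishing if the only automorphism $\phi$ of $G$ with $f(\phi(v))=f(v)$ for all vertices $v$ is the identity. Given a list assignment $L$ (a finite set $L(v)$ of colors for each vertex $v$), $G$ is properly $L$-distinguishable if there is a proper vertex coloring $f$ of $G$ which is distinguishing and satisfies $f(v)\in L(v)$ for all $v$. -}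

module Defs where

open import Data.Nat using (ℕ; suc; _%_; NonZero)
open import Data.Nat.Properties using (_≟_)
open import Data.Fin using (Fin; toℕ)
open import Data.List using (List; length; deduplicate; concat; map)
open import Data.List.Membership.Propositional using (_∈_)
open import Data.List.Relation.Unary.Unique.Propositional using (Unique)
open import Data.Product using (_×_; Σ)
open import Data.Sum using (_⊎_)
open import Function.Bundles using (_↔_; Inverse)
open import Relation.Binary.PropositionalEquality using (_≡_; _≢_)
open import Data.List using (allFin) public

Color : Set
Color = ℕ

CycleAdj : (n : ℕ) .{{_ : NonZero n}} → Fin n → Fin n → Set
CycleAdj n i j = (toℕ j ≡ suc (toℕ i) % n) ⊎ (toℕ i ≡ suc (toℕ j) % n)

IsCycleAut : (n : ℕ) .{{_ : NonZero n}} → (Fin n ↔ Fin n) → Set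
IsCycleAut n φ = ∀ u v → (CycleAdj n u v → CycleAdj n (Inverse.to φ u) (Inverse.to φ v))
                       × (CycleAdj n (Inverse.to φ u) (Inverse.to φ v) → CycleAdj n u v)

IsProper : (n : ℕ) .{{_ : NonZero n}} → (Fin n → Color) → Set
IsProper n f = ∀ u v → CycleAdj n u v → f u ≢ f v

IsDistinguishing : (n : ℕ) .{{_ : NonZero n}} → (Fin n → Color) → Set
IsDistinguishing n f = ∀ (φ : Fin n ↔ Fin n) → IsCycleAut n φ →
  (∀ v → f (Inverse.to φ v) ≡ f v) → ∀ v → Inverse.to φ v ≡ v

HasListSize : (n k : ℕ) → (Fin n → List Color) → Set
HasListSize n k L = ∀ v → Unique (L v) × length (L v) ≡ k

unionSize : (n : ℕ) → (Fin n → List Color) → ℕ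
unionSize n L = length (deduplicate _≟_ (concat (map L (allFin n))))

ProperlyLDistinguishable : (n : ℕ) .{{_ : NonZero n}} → (Fin n → List Color) → Set
ProperlyLDistinguishable n L =
  Σ (Fin n → Color) λ f → IsProper n f × IsDistinguishing n f × (∀ v → f v ∈ L v)

{-# OPTIONS --safe #-}
module Submission where

-- Give vertex 0 a colour c that no other vertex gets, and colour the path 1, …, n−1 greedily
-- from the lists with c removed. An automorphism preserving the colouring fixes 0, hence is
-- either the identity or the reflection k ↦ −k (mod n), and the reflection is ruled out by
-- any pair of mirror-image vertices with different colours: in C₅ the adjacent vertices 2
-- and 3, in C₆ the vertices 1 and 5, which the fourth colour of L(5) lets us separate.

open import Defs
open import Data.Nat using (ℕ; zero; suc; _+_; _<_; _%_; NonZero; z<s; s<s)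
open import Data.Nat.Properties
  using (_≟_; ≤-refl; ≤-pred; <-trans; <-≤-trans; n<1+n; m≤n⇒m<n∨m≡n; <⇒≢; suc-injective;
         0≢1+n; m≢1+n+m; +-suc; +-identityʳ; +-cancelˡ-≡)
open import Data.Nat.DivMod using (_mod_; m<n⇒m%n≡m; n%n≡0)
open import Data.Fin using (Fin; zero; suc; toℕ)
open import Data.Fin.Patterns using (0F; 1F; 2F; 3F; 4F; 5F)
open import Data.Fin.Properties using (toℕ-injective; toℕ<n; toℕ-fromℕ<)
open import Data.List using (List; []; _∷_; length; filter)
open import Data.List.Properties using (filter-notAll)
open import Data.List.Membership.Propositional using (_∈_; _∉_)
open import Data.List.Membership.Propositional.Properties using (∈-filter⁺)
open import Data.List.Relation.Unary.Any using (here; there)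
import Data.List.Relation.Unary.Any as Any
open import Data.List.Relation.Unary.All using (All; []; _∷_)
import Data.List.Relation.Unary.All as All
open import Data.List.Relation.Unary.All.Properties using (¬Any⇒All¬)
open import Data.List.Relation.Unary.AllPairs using (_∷_)
open import Data.List.Relation.Unary.Unique.Propositional using (Unique)
open import Data.Product using (_×_; _,_; proj₁; proj₂; ∃-syntax; ∃₂)
open import Data.Sum using (_⊎_; inj₁; inj₂)
open import Function.Bundles using (Inverse; Injection)
open import Function.Properties.Inverse using (Inverse⇒Injection)
open import Relation.Binary.Definitions using (DecidableEquality)
open import Relation.Binary.PropositionalEquality
open import Relation.Nullary using (Dec; yes; no; ¬?; contradiction)

PathAdj : ℕ → ℕ → Set
PathAdj a b = b ≡ suc a ⊎ a ≡ suc b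

module _ {b : ℕ → ℕ} {N : ℕ}
  (walk : ∀ k → suc k < N → PathAdj (b k) (b (suc k)))
  (nonBacktracking : ∀ k → suc (suc k) < N → b (suc (suc k)) ≢ b k) where

  private
    shorter : ∀ {k} → suc (suc k) < N → suc k < N
    shorter = <-trans (n<1+n _)

  keeps-ascending : b 1 ≡ suc (b 0) → ∀ k → suc k < N → b (suc k) ≡ suc (b k)
  keeps-ascending up zero _ = up
  keeps-ascending up (suc k) 2+k<N with walk (suc k) 2+k<N
  ... | inj₁ step = step
  ... | inj₂ back = contradiction
    (suc-injective (trans (sym back) (keeps-ascending up k (shorter 2+k<N))))
    (nonBacktracking k 2+k<N)

  keeps-descending : b 0 ≡ suc (b 1) → ∀ k → suc k < N → b k ≡ suc (b (suc k))
  keeps-descending down zero _ = down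
  keeps-descending down (suc k) 2+k<N with walk (suc k) 2+k<N
  ... | inj₂ step = step
  ... | inj₁ back = contradiction
    (trans back (sym (keeps-descending down k (shorter 2+k<N))))
    (nonBacktracking k 2+k<N)

  ascending : b 1 ≡ suc (b 0) → ∀ k → k < N → b k ≡ k + b 0
  ascending up zero _ = refl
  ascending up (suc k) 1+k<N =
    trans (keeps-ascending up k 1+k<N) (cong suc (ascending up k (<-trans (n<1+n k) 1+k<N)))

  descending : b 0 ≡ suc (b 1) → ∀ k → k < N → k + b k ≡ b 0
  descending down zero _ = refl
  descending down (suc k) 1+k<N = begin
    suc (k + b (suc k))  ≡⟨ +-suc k (b (suc k)) ⟨
    k + suc (b (suc k))  ≡⟨ cong (k +_) (keeps-descending down k 1+k<N) ⟨
    k + b k              ≡⟨ descending down k (<-trans (n<1+n k) 1+k<N) ⟩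
    b 0                  ∎
    where open ≡-Reasoning

suc-mod-cases : ∀ {a b n} .{{_ : NonZero n}} → a < n → b ≡ suc a % n → b ≡ suc a ⊎ (suc a ≡ n × b ≡ 0)
suc-mod-cases a<n refl with m≤n⇒m<n∨m≡n a<n
... | inj₁ 1+a<n = inj₁ (m<n⇒m%n≡m 1+a<n)
... | inj₂ refl  = inj₂ (refl , n%n≡0 _)

toℕ-mod : ∀ {k n} .{{_ : NonZero n}} → k < n → toℕ (k mod n) ≡ k
toℕ-mod k<n = trans (toℕ-fromℕ< _) (m<n⇒m%n≡m k<n)

mod-toℕ : ∀ {n} .{{_ : NonZero n}} (v : Fin n) → toℕ v mod n ≡ v
mod-toℕ v = toℕ-injective (toℕ-mod (toℕ<n v))

next : ∀ {n} .{{_ : NonZero n}} → Fin n → Fin n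
next {n} u = suc (toℕ u) mod n

adjacent-next : ∀ {n} .{{_ : NonZero n}} (u : Fin n) → CycleAdj n u (next u)
adjacent-next u = inj₁ (toℕ-fromℕ< _)

adjacent⇒next : ∀ {n} .{{_ : NonZero n}} {u v : Fin n} → CycleAdj n u v → v ≡ next u ⊎ u ≡ next v
adjacent⇒next (inj₁ e) = inj₁ (toℕ-injective (trans e (sym (toℕ-fromℕ< _))))
adjacent⇒next (inj₂ e) = inj₂ (toℕ-injective (trans e (sym (toℕ-fromℕ< _))))

consecutive-adjacent : ∀ {k n} .{{_ : NonZero n}} → suc k < n → CycleAdj n (k mod n) (suc k mod n)
consecutive-adjacent {k} {n} 1+k<n = inj₁ (trans (toℕ-fromℕ< _)
  (cong (λ i → suc i % n) (sym (toℕ-mod (<-trans (n<1+n k) 1+k<n)))))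

adjacent-nonzero⇒PathAdj : ∀ {n} .{{_ : NonZero n}} {u v : Fin n} → CycleAdj n u v →
                           toℕ u ≢ 0 → toℕ v ≢ 0 → PathAdj (toℕ u) (toℕ v)
adjacent-nonzero⇒PathAdj {u = u} (inj₁ e) _ v≢0 with suc-mod-cases (toℕ<n u) e
... | inj₁ step        = inj₁ step
... | inj₂ (_ , v≡0)   = contradiction v≡0 v≢0
adjacent-nonzero⇒PathAdj {v = v} (inj₂ e) u≢0 _ with suc-mod-cases (toℕ<n v) e
... | inj₁ step        = inj₂ step
... | inj₂ (_ , u≡0)   = contradiction u≡0 u≢0

neighbours-of-zero : ∀ {m} {w : Fin (suc m)} → CycleAdj (suc m) zero w → toℕ w ≡ 1 ⊎ suc (toℕ w) ≡ suc m
neighbours-of-zero (inj₁ e) with suc-mod-cases z<s e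
... | inj₁ w≡1           = inj₁ w≡1
... | inj₂ (1≡n , w≡0)   = inj₂ (trans (cong suc w≡0) 1≡n)
neighbours-of-zero {w = w} (inj₂ e) with suc-mod-cases (toℕ<n w) e
... | inj₁ 0≡1+w         = contradiction 0≡1+w 0≢1+n
... | inj₂ (wraps , _)   = inj₂ wraps

proper-if-next-differs : ∀ {n} .{{_ : NonZero n}} (f : Fin n → Color) →
                         (∀ u → f u ≢ f (next u)) → IsProper n f
proper-if-next-differs f differs u v adj with adjacent⇒next adj
... | inj₁ refl = differs u
... | inj₂ refl = ≢-sym (differs v)

module FixingZero {m : ℕ} (g : Fin (suc m) → Fin (suc m))
  (g-injective : ∀ {x y} → g x ≡ g y → x ≡ y)
  (g-adjacent : ∀ {u v} → CycleAdj (suc m) u v → CycleAdj (suc m) (g u) (g v))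
  (g-zero : g zero ≡ zero) where

  private
    n : ℕ
    n = suc m

    image : ℕ → ℕ
    image k = toℕ (g (k mod n))

    image-toℕ : ∀ v → image (toℕ v) ≡ toℕ (g v)
    image-toℕ v = cong (λ w → toℕ (g w)) (mod-toℕ v)

    image-injective : ∀ {j k} → j < n → k < n → image j ≡ image k → j ≡ k
    image-injective j<n k<n e =
      trans (sym (toℕ-mod j<n)) (trans (cong toℕ (g-injective (toℕ-injective e))) (toℕ-mod k<n))

    image-nonzero : ∀ {k} → suc k < n → image (suc k) ≢ 0
    image-nonzero 1+k<n e = 0≢1+n (image-injective z<s 1+k<n (trans (cong toℕ g-zero) (sym e)))

    -- The images of 0, 1, 2, … as numbers, except that g 0 = 0 is read as r ∈ {0, n},
    -- whichever makes the first step a unit step.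
    walkFrom : ℕ → ℕ → ℕ
    walkFrom r zero    = r
    walkFrom r (suc k) = image (suc k)

    walk : ∀ {r} → PathAdj r (image 1) → ∀ k → suc k < n → PathAdj (walkFrom r k) (walkFrom r (suc k))
    walk start zero    _      = start
    walk _     (suc k) 2+k<n  = adjacent-nonzero⇒PathAdj (g-adjacent (consecutive-adjacent 2+k<n))
      (image-nonzero (<-trans (n<1+n _) 2+k<n)) (image-nonzero 2+k<n)

    nonBacktracking : ∀ {r} → (∀ {k} → suc k < n → image (suc k) ≢ r) →
                      ∀ k → suc (suc k) < n → walkFrom r (suc (suc k)) ≢ walkFrom r k
    nonBacktracking avoids zero    2<n     = avoids 2<n
    nonBacktracking _      (suc k) 3+k<n e =
      m≢1+n+m (suc k) {1} (sym (image-injective 3+k<n (<-trans (n<1+n _) (<-trans (n<1+n _) 3+k<n)) e))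

  identity⊎reflection : (∀ v → g v ≡ v) ⊎ (∀ v → v ≢ zero → toℕ v + toℕ (g v) ≡ suc m)
  identity⊎reflection
    with neighbours-of-zero (subst (λ z → CycleAdj n z (g (1 mod n))) g-zero (g-adjacent (adjacent-next zero)))
  ... | inj₁ g1≡1 = inj₁ fixes
    where
    fixes : ∀ v → g v ≡ v
    fixes zero      = g-zero
    fixes v@(suc _) = toℕ-injective (begin
      toℕ (g v)       ≡⟨ image-toℕ v ⟨
      image (toℕ v)   ≡⟨ ascending (walk (inj₁ g1≡1)) (nonBacktracking image-nonzero) g1≡1 (toℕ v) (toℕ<n v) ⟩
      toℕ v + 0       ≡⟨ +-identityʳ _ ⟩
      toℕ v           ∎)
      where open ≡-Reasoning
  ... | inj₂ 1+g1≡n = inj₂ reflects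
    where
    reflects : ∀ v → v ≢ zero → toℕ v + toℕ (g v) ≡ n
    reflects zero      v≢0 = contradiction refl v≢0
    reflects v@(suc _) _   = begin
      toℕ v + toℕ (g v)      ≡⟨ cong (toℕ v +_) (image-toℕ v) ⟨
      toℕ v + image (toℕ v)  ≡⟨ descending (walk (inj₂ (sym 1+g1≡n)))
                                  (nonBacktracking (λ _ → <⇒≢ (toℕ<n _))) (sym 1+g1≡n) (toℕ v) (toℕ<n v) ⟩
      n                      ∎
      where open ≡-Reasoning

unique-colour∧asymmetric⇒distinguishing : ∀ {m} (f : Fin (suc m) → Color) →
  (∀ v → f v ≡ f zero → v ≡ zero) →
  (∃₂ λ u v → toℕ u + toℕ v ≡ suc m × f u ≢ f v) →
  IsDistinguishing (suc m) f
unique-colour∧asymmetric⇒distinguishing f unique (u , v , mirror , fu≢fv) φ aut preserves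
  with FixingZero.identity⊎reflection (Inverse.to φ) (Injection.injective (Inverse⇒Injection φ))
         (λ {x} {y} → proj₁ (aut x y)) (unique _ (preserves zero))
... | inj₁ identity   = identity
... | inj₂ reflection = contradiction (trans (sym (preserves u)) (cong f gu≡v)) fu≢fv
  where
  u≢0 : u ≢ zero
  u≢0 refl = <⇒≢ (toℕ<n v) mirror

  gu≡v : Inverse.to φ u ≡ v
  gu≡v = toℕ-injective (+-cancelˡ-≡ (toℕ u) _ _ (trans (reflection u u≢0) (sym mirror)))

module _ {a} {A : Set a} (_≟ᴬ_ : DecidableEquality A) where
  open import Data.List.Membership.DecPropositional _≟ᴬ_ using (_∈?_)

  private
    _≢?_ : (x y : A) → Dec (x ≢ y)
    x ≢? y = ¬? (x ≟ᴬ y)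

  unique-longer⇒∃∉ : ∀ {xs : List A} ys → Unique xs → length ys < length xs → ∃[ x ] x ∈ xs × x ∉ ys
  unique-longer⇒∃∉ {[]}     _  _              ()
  unique-longer⇒∃∉ {x ∷ xs} ys (x≢xs ∷ unique) |ys|<|x∷xs| with x ∈? ys
  ... | no x∉ys = x , here refl , x∉ys
  ... | yes x∈ys
    with y , y∈xs , y∉ys′ ← unique-longer⇒∃∉ (filter (x ≢?_) ys) unique
           (<-≤-trans (filter-notAll (x ≢?_) ys (Any.map (λ x≡y x≢y → x≢y x≡y) x∈ys)) (≤-pred |ys|<|x∷xs|))
    = y , there y∈xs , λ y∈ys → y∉ys′ (∈-filter⁺ (x ≢?_) y∈ys (All.lookup x≢xs y∈xs))

choose-avoiding : ∀ {n k} (L : Fin n → List Color) → HasListSize n k L →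
                  ∀ v ys → length ys < k → ∃[ x ] x ∈ L v × All (x ≢_) ys
choose-avoiding L sized v ys |ys|<k
  with x , x∈L , x∉ys ← unique-longer⇒∃∉ _≟_ ys (proj₁ (sized v))
      (subst (length ys <_) (sym (proj₂ (sized v))) |ys|<k)
  = x , x∈L , ¬Any⇒All¬ ys x∉ys

C₅-properly-distinguishable : (L : Fin 5 → List Color) → HasListSize 5 3 L → ProperlyLDistinguishable 5 L
C₅-properly-distinguishable L sized
  with c  , c∈L  , _                  ← choose-avoiding L sized 0F [] z<s
  with x₁ , x₁∈L , x₁≢c ∷ []          ← choose-avoiding L sized 1F (c ∷ []) (s<s z<s)
  with x₂ , x₂∈L , x₂≢c ∷ x₂≢x₁ ∷ []  ← choose-avoiding L sized 2F (c ∷ x₁ ∷ []) ≤-refl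
  with x₃ , x₃∈L , x₃≢c ∷ x₃≢x₂ ∷ []  ← choose-avoiding L sized 3F (c ∷ x₂ ∷ []) ≤-refl
  with x₄ , x₄∈L , x₄≢c ∷ x₄≢x₃ ∷ []  ← choose-avoiding L sized 4F (c ∷ x₃ ∷ []) ≤-refl
  = f
  , proper-if-next-differs f next-differs
  , unique-colour∧asymmetric⇒distinguishing f unique (2F , 3F , refl , ≢-sym x₃≢x₂)
  , f∈L
  where
  f : Fin 5 → Color
  f 0F = c
  f 1F = x₁
  f 2F = x₂
  f 3F = x₃
  f 4F = x₄

  next-differs : ∀ u → f u ≢ f (next u)
  next-differs 0F = ≢-sym x₁≢c
  next-differs 1F = ≢-sym x₂≢x₁
  next-differs 2F = ≢-sym x₃≢x₂
  next-differs 3F = ≢-sym x₄≢x₃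
  next-differs 4F = x₄≢c

  unique : ∀ v → f v ≡ c → v ≡ 0F
  unique 0F _    = refl
  unique 1F x₁≡c = contradiction x₁≡c x₁≢c
  unique 2F x₂≡c = contradiction x₂≡c x₂≢c
  unique 3F x₃≡c = contradiction x₃≡c x₃≢c
  unique 4F x₄≡c = contradiction x₄≡c x₄≢c

  f∈L : ∀ v → f v ∈ L v
  f∈L 0F = c∈L
  f∈L 1F = x₁∈L
  f∈L 2F = x₂∈L
  f∈L 3F = x₃∈L
  f∈L 4F = x₄∈L

C₆-properly-distinguishable : (L : Fin 6 → List Color) → HasListSize 6 4 L → ProperlyLDistinguishable 6 L
C₆-properly-distinguishable L sized
  with c  , c∈L  , _                         ← choose-avoiding L sized 0F [] z<s
  with x₁ , x₁∈L , x₁≢c ∷ []                 ← choose-avoiding L sized 1F (c ∷ []) (s<s z<s)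
  with x₂ , x₂∈L , x₂≢c ∷ x₂≢x₁ ∷ []         ← choose-avoiding L sized 2F (c ∷ x₁ ∷ []) (s<s (s<s z<s))
  with x₃ , x₃∈L , x₃≢c ∷ x₃≢x₂ ∷ []         ← choose-avoiding L sized 3F (c ∷ x₂ ∷ []) (s<s (s<s z<s))
  with x₄ , x₄∈L , x₄≢c ∷ x₄≢x₃ ∷ []         ← choose-avoiding L sized 4F (c ∷ x₃ ∷ []) (s<s (s<s z<s))
  with x₅ , x₅∈L , x₅≢c ∷ x₅≢x₄ ∷ x₅≢x₁ ∷ []  ← choose-avoiding L sized 5F (c ∷ x₄ ∷ x₁ ∷ []) ≤-refl
  = f
  , proper-if-next-differs f next-differs
  , unique-colour∧asymmetric⇒distinguishing f unique (1F , 5F , refl , ≢-sym x₅≢x₁)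
  , f∈L
  where
  f : Fin 6 → Color
  f 0F = c
  f 1F = x₁
  f 2F = x₂
  f 3F = x₃
  f 4F = x₄
  f 5F = x₅

  next-differs : ∀ u → f u ≢ f (next u)
  next-differs 0F = ≢-sym x₁≢c
  next-differs 1F = ≢-sym x₂≢x₁
  next-differs 2F = ≢-sym x₃≢x₂
  next-differs 3F = ≢-sym x₄≢x₃
  next-differs 4F = ≢-sym x₅≢x₄
  next-differs 5F = x₅≢c

  unique : ∀ v → f v ≡ c → v ≡ 0F
  unique 0F _    = refl
  unique 1F x₁≡c = contradiction x₁≡c x₁≢c
  unique 2F x₂≡c = contradiction x₂≡c x₂≢c
  unique 3F x₃≡c = contradiction x₃≡c x₃≢c
  unique 4F x₄≡c = contradiction x₄≡c x₄≢c
  unique 5F x₅≡c = contradiction x₅≡c x₅≢c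

  f∈L : ∀ v → f v ∈ L v
  f∈L 0F = c∈L
  f∈L 1F = x₁∈L
  f∈L 2F = x₂∈L
  f∈L 3F = x₃∈L
  f∈L 4F = x₄∈L
  f∈L 5F = x₅∈L

proposition2p3 :
    ((L : Fin 5 → List Color) → HasListSize 5 3 L → unionSize 5 L ≢ 3 →
        ProperlyLDistinguishable 5 L)
    × ((L : Fin 6 → List Color) → HasListSize 6 4 L → unionSize 6 L ≢ 4 →
        ProperlyLDistinguishable 6 L)
proposition2p3 = (λ L sized _ → C₅-properly-distinguishable L sized)
               , (λ L sized _ → C₆-properly-distinguishable L sized)
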